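{- Let $P$ be a finite interval order, $g$ a circulation of its key graph $G_P$, and $C_1,\dots,C_t$ ($t\ge2$) concordant cycles in $\mathrm{supp}(g)$. If $C_i\cup C_j$ contains no discordant cycle for all $1\le i<j\le t$, then $\bigcup_{i=1}^tC_i$ contains no discordant cycle.
   Context: A finite partial order $P=([n],\prec)$ is an interval order if there are compact real intervals $I_x=[\ell_x,r_x]$ with $x\prec y$ iff $r_x<\ell_y$; write $x\parallel y$ if $x\ne y$ are incomparable. The canonical representation $[\ell_x,r_x]_{x\in[n]}$ of $P$ is the (unique) representation using the minimum number $m$ of distinct endpoints, placed at $0,\dots,m-1$. For $y\not\prec x$, the slack of $(x,y)$ there is $\ell_y-r_x-1$ if $x\prec y$, $r_y-\ell_x$ if $x\parallel y$, $r_x-\ell_x$ if $x=y$; slack-$0$ pairs are slack zero pairs, called cover pairs if $x\prec y$ and sharp pairs if $x\parallel y$. The key graph $G_P$ has vertex set $\{\rho_1,\dots,\rho_n\}$ and colored arcs, each with a weight that is a linear inequality in $\ell_1,\dots,\ell_n,\rho_1,\dots,\rho_n$: a blue arc $\rho_x\to\rho_y$ of weight $\langle\ell_x+\rho_x+1\le\ell_y\rangle$ for each slack zero cover pair; a red arc $\rho_x\to\rho_y$ of weight $\langle\ell_x\le\ell_y+\rho_y\rangle$ for each slack zero sharp pair; a red loop at $\rho_x$ of weight $\langle-\rho_x\le0\rangle$ for each slack zero pair $(x,x)$. Inequalities are added termwise and scaled by nonnegative scalars, with cancellation of terms occurring on both sides. A circulation is a map $g$ from arcs to $\mathbb R_{\ge0}$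 with flow conservation at every vertex; $\mathrm{supp}(g)$ is the subgraph of arcs with nonzero flow; $W(g)=\sum_ag(a)w(a)$ (all $\ell$-variables cancel). A directed cycle $C$ is identified with the circulation equal to $1$ on its arcs; $W(C)$ is its cycle inequality. A cycle $C$ in $\mathrm{supp}(g)$ is concordant if $W(C)=W(g)$ and discordant otherwise.
   Formalization: The circulation g takes values in the nonnegative rationals rather than in $\mathbb R_{\ge0}$. -}

module Defs where

open import Data.Nat as ℕ using (ℕ; suc)
open import Data.Fin using (Fin)
open import Data.Fin.Properties using () renaming (_≟_ to _≟ᶠ_)
open import Data.List using (List; []; _∷_; map; _++_; foldr; length; deduplicate; filter; concatMap; allFin)
open import Data.List.Relation.Unary.All using (All)
open import Data.List.Relation.Unary.Unique.Propositional using (Unique)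
open import Data.List.Membership.Propositional using (_∈_)
open import Data.Rational as ℚ using (ℚ; 0ℚ; 1ℚ)
open import Data.Product using (Σ; ∃; _×_; _,_)
open import Data.Sum using (_⊎_)
open import Relation.Nullary using (¬_)
open import Relation.Binary.PropositionalEquality using (_≡_; _≢_)

IsRep : ∀ {n} → (Fin n → Fin n → Set) → (Fin n → ℕ) → (Fin n → ℕ) → Set
IsRep {n} _≺_ ℓ r =
  (∀ x → ℓ x ℕ.≤ r x) × (∀ x y → (x ≺ y → r x ℕ.< ℓ y) × (r x ℕ.< ℓ y → x ≺ y))

endpoints : ∀ {n} → (Fin n → ℕ) → (Fin n → ℕ) → List ℕ
endpoints {n} ℓ r = map ℓ (allFin n) ++ map r (allFin n)

#endpoints : ∀ {n} → (Fin n → ℕ) → (Fin n → ℕ) → ℕ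
#endpoints ℓ r = length (deduplicate ℕ._≟_ (endpoints ℓ r))

IsCanonical : ∀ {n} → (Fin n → Fin n → Set) → (Fin n → ℕ) → (Fin n → ℕ) → Set
IsCanonical {n} _≺_ ℓ r =
  IsRep _≺_ ℓ r
  × (∀ e → e ∈ endpoints ℓ r → e ℕ.< #endpoints ℓ r)
  × (∀ e → e ℕ.< #endpoints ℓ r → e ∈ endpoints ℓ r)
  × (∀ ℓ' r' → IsRep _≺_ ℓ' r' → #endpoints ℓ r ℕ.≤ #endpoints ℓ' r')

_∥[_]_ : ∀ {n} → Fin n → (Fin n → Fin n → Set) → Fin n → Set
x ∥[ _≺_ ] y = x ≢ y × ¬ (x ≺ y) × ¬ (y ≺ x)

-- Key graph: vertices ρ_1 … ρ_n (indexed by Fin n); arcs are triples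
-- (kind , tail , head); IsArc says which triples are arcs of G_P.

data Kind : Set where
  blue red loop : Kind

record Arc (n : ℕ) : Set where
  constructor arc
  field
    kind : Kind
    src  : Fin n
    tgt  : Fin n
open Arc public

IsArc : ∀ {n} → (Fin n → Fin n → Set) → (Fin n → ℕ) → (Fin n → ℕ) → Arc n → Set
IsArc _≺_ ℓ r (arc blue x y) = x ≺ y × ℓ y ≡ suc (r x)
IsArc _≺_ ℓ r (arc red x y)  = x ∥[ _≺_ ] y × r y ≡ ℓ x
IsArc _≺_ ℓ r (arc loop x y) = x ≡ y × r x ≡ ℓ x

allKinds : List Kind
allKinds = blue ∷ red ∷ loop ∷ []

allArcs : (n : ℕ) → List (Arc n)
allArcs n = concatMap (λ k → concatMap (λ x → map (λ y → arc k x y) (allFin n)) (allFin n)) allKinds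

-- Linear inequalities in ℓ_1..ℓ_n, ρ_1..ρ_n, stored in difference form
-- "RHS - LHS ≥ 0": coefficients of ℓ's, of ρ's, and a constant.

record Form (n : ℕ) : Set where
  constructor form
  field
    ℓc : Fin n → ℚ
    ρc : Fin n → ℚ
    cst : ℚ
open Form public

_⊕_ : ∀ {n} → Form n → Form n → Form n
f ⊕ h = form (λ i → ℓc f i ℚ.+ ℓc h i) (λ i → ρc f i ℚ.+ ρc h i) (cst f ℚ.+ cst h)

_⊛_ : ∀ {n} → ℚ → Form n → Form n
c ⊛ f = form (λ i → c ℚ.* ℓc f i) (λ i → c ℚ.* ρc f i) (c ℚ.* cst f)

zeroF : ∀ {n} → Form n
zeroF = form (λ _ → 0ℚ) (λ _ → 0ℚ) 0ℚ

δ : ∀ {n} → Fin n → Fin n → ℚ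
δ i j with i ≟ᶠ j
... | Relation.Nullary.yes _ = 1ℚ
... | Relation.Nullary.no _ = 0ℚ

weight : ∀ {n} → Arc n → Form n
-- ⟨ ℓ_x + ρ_x + 1 ≤ ℓ_y ⟩  ↦  ℓ_y - ℓ_x - ρ_x - 1 ≥ 0
weight (arc blue x y) =
  form (λ i → δ y i ℚ.- δ x i) (λ i → ℚ.- δ x i) (ℚ.- 1ℚ)
-- ⟨ ℓ_x ≤ ℓ_y + ρ_y ⟩  ↦  ℓ_y + ρ_y - ℓ_x ≥ 0
weight (arc red x y) =
  form (λ i → δ y i ℚ.- δ x i) (λ i → δ y i) 0ℚ
-- ⟨ -ρ_x ≤ 0 ⟩  ↦  ρ_x ≥ 0
weight (arc loop x y) =
  form (λ _ → 0ℚ) (λ i → δ x i) 0ℚ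

_≈ᶠ_ : ∀ {n} → Form n → Form n → Set
f ≈ᶠ h = Σ ℚ λ c → (0ℚ ℚ.< c)
  × (∀ i → ℓc f i ≡ c ℚ.* ℓc h i) × (∀ i → ρc f i ≡ c ℚ.* ρc h i) × (cst f ≡ c ℚ.* cst h)

sumℚ : List ℚ → ℚ
sumℚ = foldr ℚ._+_ 0ℚ

sumF : ∀ {n} → List (Form n) → Form n
sumF = foldr _⊕_ zeroF

-- Circulations: maps g from arcs to ℚ≥0 (extended by 0 to non-arcs)
-- with flow conservation at every vertex.

inflow : ∀ {n} → (Arc n → ℚ) → Fin n → ℚ
inflow {n} g v = sumℚ (map g (filter (λ a → tgt a ≟ᶠ v) (allArcs n)))

outflow : ∀ {n} → (Arc n → ℚ) → Fin n → ℚ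
outflow {n} g v = sumℚ (map g (filter (λ a → src a ≟ᶠ v) (allArcs n)))

IsCirculation : ∀ {n} → (Fin n → Fin n → Set) → (Fin n → ℕ) → (Fin n → ℕ) → (Arc n → ℚ) → Set
IsCirculation {n} _≺_ ℓ r g =
  (∀ a → 0ℚ ℚ.≤ g a)
  × (∀ a → g a ≢ 0ℚ → IsArc _≺_ ℓ r a)
  × (∀ v → inflow g v ≡ outflow g v)

Wcirc : ∀ {n} → (Arc n → ℚ) → Form n
Wcirc {n} g = sumF (map (λ a → g a ⊛ weight a) (allArcs n))

PathFrom : ∀ {n} → Fin n → List (Arc n) → Fin n → Set
PathFrom v [] w = v ≡ w
PathFrom v (a ∷ as) w = src a ≡ v × PathFrom (tgt a) as w

record Cycle (n : ℕ) : Set where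
  constructor cycle
  field
    arcs   : List (Arc n)
    nonempty : arcs ≢ []
    start  : Fin n
    closed : PathFrom start arcs start
    simple : Unique (map src arcs)
open Cycle public

-- W(C): the circulation equal to 1 on the arcs of C
Wcyc : ∀ {n} → Cycle n → Form n
Wcyc C = sumF (map weight (arcs C))

InSupp : ∀ {n} → (Arc n → ℚ) → Cycle n → Set
InSupp g C = All (λ a → g a ≢ 0ℚ) (arcs C)

Concordant : ∀ {n} → (Arc n → ℚ) → Cycle n → Set
Concordant g C = InSupp g C × Wcyc C ≈ᶠ Wcirc g

Discordant : ∀ {n} → (Arc n → ℚ) → Cycle n → Set
Discordant g C = InSupp g C × ¬ (Wcyc C ≈ᶠ Wcirc g)

-- Every arc inequality of the key graph is tight at the canonical representation (ℓ, ρ = r - ℓ),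
-- so the inequality of a cycle is determined by its ρ-part, and the ρ-coefficient of a cycle at a
-- vertex x is fixed by the kinds of its two arcs at x. The ρ-parts of concordant cycles are positive
-- multiples of that of g, so they have the same support K and the same signs; it suffices to show
-- that a cycle D in the union has the ρ-part of one C_i. At a vertex of K the sign forces the kinds
-- of all arcs of the C_i there, so D gets the common coefficient. At a vertex x of D outside K,
-- splice the cycles C_j and C_k carrying the arcs of D at x through a vertex z ∈ K: the resulting
-- cycle lies in C_j ∪ C_k, so it is not discordant, and its coefficient at x, which is D's, is 0.
-- Finally D contains K: if it missed z ∈ K but met y ∈ K, then going around D from y, splicing shows
-- that y stays before the current vertex on every C_i traversed from z, until y precedes itself;
-- and if D missed K entirely its ρ-part would vanish, which no cycle's does.

module Submission where

open import Defs
open import Data.Nat using (ℕ; zero; suc; _≤_; s≤s)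
open import Data.Fin as Fin using (Fin; _<_)
open import Data.Fin.Properties using (suc-injective; ¬∀⟶∃¬; <-cmp) renaming (_≟_ to _≟ᶠ_)
open import Data.List using (List; []; _∷_; map; _++_; [_])
open import Data.List.Properties using (map-++; ++-assoc; ∷-injective)
open import Data.List.Membership.Propositional using (_∈_; _∉_)
open import Data.List.Membership.Propositional.Properties using (∈-map⁺; ∈-map⁻; ∈-++⁺ˡ; ∈-++⁺ʳ; ∈-++⁻; ∈-∃++)
import Data.List.Membership.DecPropositional as DecMembership
open import Data.List.Relation.Binary.Disjoint.Propositional using (Disjoint)
open import Data.List.Relation.Binary.Permutation.Propositional using (_↭_; ↭-refl; ↭-sym; ↭⇒↭ₛ)
open import Data.List.Relation.Binary.Permutation.Propositional.Properties using (∈-resp-↭; ++-comm)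
import Data.List.Relation.Binary.Permutation.Propositional.Properties as ↭
open import Data.List.Relation.Binary.Permutation.Setoid.Properties using (Unique-resp-↭)
open import Data.List.Relation.Unary.Any using (here; there)
open import Data.List.Relation.Unary.All as All using (All; []; _∷_)
open import Data.List.Relation.Unary.All.Properties using (¬Any⇒All¬; ++⁻ʳ; map⁺)
open import Data.List.Relation.Unary.Unique.Propositional using (Unique; []; _∷_)
open import Data.List.Relation.Unary.Unique.Propositional.Properties using (Unique[x∷xs]⇒x∉xs)
open import Data.Rational as ℚ using (ℚ; 0ℚ; 1ℚ; _+_; _*_; -_; _-_)
import Data.Rational.Properties as ℚP
open import Data.Rational.Solver using (module +-*-Solver)
open import Algebra.Properties.CommutativeMonoid.Sum ℚP.+-0-commutativeMonoid using (sum-syntax; sum-cong-≗; ∑-distrib-+; sum-replicate-zero)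
open import Algebra.Properties.Group ℚP.+-0-group using (∙-cancelˡ)
open import Data.Product using (Σ; ∃; ∃₂; _×_; _,_; proj₁; proj₂)
open import Data.Sum as Sum using (_⊎_; inj₁; inj₂; [_,_]′; swap; reduce)
open import Data.Empty using (⊥; ⊥-elim)
open import Function using (_∘_; id; _⇔_; mk⇔; Equivalence)
open import Relation.Binary using (Tri; tri<; tri≈; tri>)
open import Relation.Nullary using (¬_; Dec; yes; no)
open import Relation.Nullary.Decidable using (decidable-stable)
open import Relation.Binary.PropositionalEquality using (_≡_; _≢_; refl; sym; trans; cong; cong₂; subst; setoid; module ≡-Reasoning)

open +-*-Solver using (solve; _:=_; _:+_; _:*_; :-_; _:-_; con)
open Equivalence using (to; from)

-- Lists without repetition

module _ {A : Set} where

  Unique-++⇒Disjoint : ∀ {xs ys : List A} → Unique (xs ++ ys) → Disjoint xs ys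
  Unique-++⇒Disjoint {x ∷ xs} (x∉ ∷ u) (here refl , y∈) = All.lookup (++⁻ʳ xs x∉) y∈ refl
  Unique-++⇒Disjoint {x ∷ xs} (_ ∷ u) (there y∈xs , y∈) = Unique-++⇒Disjoint u (y∈xs , y∈)

  some-member : ∀ (xs : List A) → xs ≢ [] → ∃ (_∈ xs)
  some-member []      []≢[] = ⊥-elim ([]≢[] refl)
  some-member (x ∷ _) _     = x , here refl

  Unique-++⁻ʳ : ∀ (xs : List A) {ys} → Unique (xs ++ ys) → Unique ys
  Unique-++⁻ʳ []       u       = u
  Unique-++⁻ʳ (x ∷ xs) (_ ∷ u) = Unique-++⁻ʳ xs u

  Unique-map⇒injective : ∀ {B : Set} (f : A → B) {xs a b} →
                         Unique (map f xs) → a ∈ xs → b ∈ xs → f a ≡ f b → a ≡ b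
  Unique-map⇒injective f (_ ∷ _)  (here refl) (here refl) _ = refl
  Unique-map⇒injective f (fx∉ ∷ _) (here refl) (there b∈) e = ⊥-elim (All.lookup fx∉ (∈-map⁺ f b∈) e)
  Unique-map⇒injective f (fx∉ ∷ _) (there a∈) (here refl) e = ⊥-elim (All.lookup fx∉ (∈-map⁺ f a∈) (sym e))
  Unique-map⇒injective f (_ ∷ u)  (there a∈) (there b∈) e = Unique-map⇒injective f u a∈ b∈ e

  ++-∷-cancelˡ : ∀ {us us' ws ws' : List A} {x} → Unique (us ++ x ∷ ws) →
                 us ++ x ∷ ws ≡ us' ++ x ∷ ws' → us ≡ us'
  ++-∷-cancelˡ {[]}     {[]}       _       _ = refl
  ++-∷-cancelˡ {[]}     {u' ∷ us'} (x∉ ∷ _) e with ∷-injective e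
  ... | refl , ws≡ = ⊥-elim (All.lookup x∉ (subst (_ ∈_) (sym ws≡) (∈-++⁺ʳ us' (here refl))) refl)
  ++-∷-cancelˡ {u ∷ us} {[]}       (u∉ ∷ _) e with ∷-injective e
  ... | refl , _ = ⊥-elim (All.lookup u∉ (∈-++⁺ʳ us (here refl)) refl)
  ++-∷-cancelˡ {u ∷ us} {u' ∷ us'} (_ ∷ u!) e with ∷-injective e
  ... | refl , e' = cong (u ∷_) (++-∷-cancelˡ u! e')

  Precedes : A → A → List A → Set
  Precedes k x vs = ∃₂ λ us ws → vs ≡ us ++ x ∷ ws × k ∈ us

  Precedes⇒∈prefix : ∀ {vs us ws k x} → Unique vs → vs ≡ us ++ x ∷ ws → Precedes k x vs → k ∈ us
  Precedes⇒∈prefix u! refl (us' , ws' , e , k∈) = subst (_ ∈_) (sym (++-∷-cancelˡ u! e)) k∈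

  Precedes-irrefl : ∀ {vs x} → Unique vs → ¬ Precedes x x vs
  Precedes-irrefl u! (us , ws , refl , x∈) = Unique-++⇒Disjoint u! (x∈ , here refl)

  Precedes-next : ∀ {vs us ws k u v} → Unique vs → vs ≡ us ++ u ∷ v ∷ ws →
                  Precedes k u vs ⊎ k ≡ u → Precedes k v vs
  Precedes-next {us = us} {ws} {u = u} {v} u! e k≼u =
    us ++ [ u ] , ws , trans e (sym (++-assoc us [ u ] (v ∷ ws))) ,
    [ (λ k≺u → ∈-++⁺ˡ (Precedes⇒∈prefix u! e k≺u)) , (λ { refl → ∈-++⁺ʳ us (here refl) }) ]′ k≼u

-- Walks and simple cycles

module _ {n : ℕ} where

  srcs tgts : List (Arc n) → List (Fin n)
  srcs = map src
  tgts = map tgt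

  vertices : Cycle n → List (Fin n)
  vertices E = srcs (arcs E)

  path-++⁺ : ∀ {u v w} (p : List (Arc n)) {q} → PathFrom u p v → PathFrom v q w → PathFrom u (p ++ q) w
  path-++⁺ []      refl     h = h
  path-++⁺ (a ∷ p) (e , h₁) h = e , path-++⁺ p h₁ h

  path-++⁻ : ∀ {u w} (p : List (Arc n)) {q} → PathFrom u (p ++ q) w → ∃ λ v → PathFrom u p v × PathFrom v q w
  path-++⁻ []      h       = _ , refl , h
  path-++⁻ (a ∷ p) (e , h) with path-++⁻ p h
  ... | v , h₁ , h₂ = v , (e , h₁) , h₂

  record Split (u : Fin n) (as : List (Arc n)) (v : Fin n) (c : Arc n) : Set where
    field
      pre suf  : List (Arc n)
      as≡      : as ≡ pre ++ c ∷ suf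
      pre-path : PathFrom u pre (src c)
      suf-path : PathFrom (tgt c) suf v

    srcs≡ : srcs as ≡ srcs pre ++ src c ∷ srcs suf
    srcs≡ = trans (cong srcs as≡) (map-++ src pre (c ∷ suf))

  split : ∀ {u v c} {as : List (Arc n)} → PathFrom u as v → c ∈ as → Split u as v c
  split {as = as} h c∈ with ∈-∃++ c∈
  ... | pre , suf , refl with path-++⁻ pre h
  ... | _ , h₁ , (refl , h₂) = record { pre = pre ; suf = suf ; as≡ = refl ; pre-path = h₁ ; suf-path = h₂ }

  consecutive : ∀ {u v c} {as : List (Arc n)} → PathFrom u as v → c ∈ as → tgt c ≢ v →
                ∃₂ λ us ws → srcs as ≡ us ++ src c ∷ tgt c ∷ ws
  consecutive {c = c} h c∈ tgt≢v with split h c∈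
  ... | record { suf = [] ; suf-path = refl } = ⊥-elim (tgt≢v refl)
  ... | record { pre = pre ; suf = c' ∷ suf ; as≡ = refl ; suf-path = (src≡ , _) } =
    srcs pre , srcs suf , trans (map-++ src pre (c ∷ c' ∷ suf)) (cong (λ w → srcs pre ++ src c ∷ w ∷ srcs suf) src≡)

  tgts-path : ∀ {u v} (a : Arc n) (as : List (Arc n)) → PathFrom u (a ∷ as) v → tgts (a ∷ as) ≡ srcs as ++ [ v ]
  tgts-path a []       (_ , refl)     = refl
  tgts-path a (b ∷ as) (_ , e , h) = cong₂ _∷_ (sym e) (tgts-path b as (e , h))

  tgt-later : ∀ {u v c b} {ps : List (Arc n)} → PathFrom u (c ∷ ps) v → b ∈ c ∷ ps → tgt b ∈ srcs ps ⊎ tgt b ≡ v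
  tgt-later {c = c} {ps = ps} h b∈ with ∈-++⁻ (srcs ps) (subst (_ ∈_) (tgts-path c ps h) (∈-map⁺ tgt b∈))
  ... | inj₁ ∈srcs     = inj₁ ∈srcs
  ... | inj₂ (here e) = inj₂ e

  tgts↭srcs : ∀ {u} (as : List (Arc n)) → PathFrom u as u → tgts as ↭ srcs as
  tgts↭srcs []       _           = ↭-refl
  tgts↭srcs (a ∷ as) h@(refl , _) = subst (_↭ srcs (a ∷ as)) (sym (tgts-path a as h)) (++-comm (srcs as) [ src a ])

  rotate-walk : ∀ {u a} (as : List (Arc n)) → PathFrom u as u → a ∈ as →
                ∃ λ rest → as ↭ a ∷ rest × PathFrom (src a) (a ∷ rest) (src a)
  rotate-walk {a = a} as h a∈ with ∈-∃++ a∈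
  ... | p , q , refl with path-++⁻ p h
  ... | _ , h₁ , (e , h₂) = q ++ p , ++-comm p (a ∷ q) , refl , path-++⁺ q h₂ (subst (PathFrom _ p) (sym e) h₁)

  module _ (E : Cycle n) where

    tgts↭vertices : tgts (arcs E) ↭ vertices E
    tgts↭vertices = tgts↭srcs (arcs E) (closed E)

    unique-tgts : Unique (tgts (arcs E))
    unique-tgts = Unique-resp-↭ (setoid (Fin n)) (↭⇒↭ₛ (↭-sym tgts↭vertices)) (simple E)

    tgt∈vertices : ∀ {b} → b ∈ arcs E → tgt b ∈ vertices E
    tgt∈vertices b∈ = ∈-resp-↭ tgts↭vertices (∈-map⁺ tgt b∈)

    in-arc : ∀ {x} → x ∈ vertices E → ∃ λ b → b ∈ arcs E × tgt b ≡ x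
    in-arc x∈ with ∈-map⁻ tgt (∈-resp-↭ (↭-sym tgts↭vertices) x∈)
    ... | b , b∈ , refl = b , b∈ , refl

    out-arc : ∀ {x} → x ∈ vertices E → ∃ λ a → a ∈ arcs E × src a ≡ x
    out-arc x∈ with ∈-map⁻ src x∈
    ... | a , a∈ , refl = a , a∈ , refl

    record Rotation (a : Arc n) : Set where
      field
        rest : List (Arc n)
        perm : arcs E ↭ a ∷ rest
        path : PathFrom (src a) (a ∷ rest) (src a)

      vertices-perm : vertices E ↭ srcs (a ∷ rest)
      vertices-perm = ↭.map⁺ src perm

      unique : Unique (srcs (a ∷ rest))
      unique = Unique-resp-↭ (setoid (Fin n)) (↭⇒↭ₛ vertices-perm) (simple E)

      ∈⁺ : ∀ {c} → c ∈ arcs E → c ∈ a ∷ rest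
      ∈⁺ = ∈-resp-↭ perm

      ∈⁻ : ∀ {c} → c ∈ a ∷ rest → c ∈ arcs E
      ∈⁻ = ∈-resp-↭ (↭-sym perm)

    rotate : ∀ {a} → a ∈ arcs E → Rotation a
    rotate a∈ with rotate-walk (arcs E) (closed E) a∈
    ... | rest , perm , path = record { rest = rest ; perm = perm ; path = path }

  record SimplePath (u v : Fin n) (ws : List (Arc n)) : Set where
    field
      steps  : List (Arc n)
      path   : PathFrom u steps v
      unique : Unique (srcs steps)
      v∉     : v ∉ srcs steps
      ⊆ws    : ∀ {c} → c ∈ steps → c ∈ ws

  open SimplePath

  SimplePath-suffix : ∀ {w u v ws} (sp : SimplePath w v ws) → u ∈ srcs (steps sp) → SimplePath u v ws
  SimplePath-suffix sp u∈ with ∈-map⁻ src u∈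
  ... | c , c∈ , refl = record
    { steps  = c ∷ suf
    ; path   = refl , suf-path
    ; unique = Unique-++⁻ʳ (srcs pre) (subst Unique srcs≡ (unique sp))
    ; v∉     = λ v∈ → v∉ sp (subst (_ ∈_) (sym srcs≡) (∈-++⁺ʳ (srcs pre) v∈))
    ; ⊆ws    = λ c'∈ → ⊆ws sp (subst (_ ∈_) (sym as≡) (∈-++⁺ʳ pre c'∈))
    }
    where open Split (split (path sp) c∈)

  SimplePath-weaken : ∀ {u v ws ws'} → (∀ {c} → c ∈ ws → c ∈ ws') → SimplePath u v ws → SimplePath u v ws'
  SimplePath-weaken ⊆ sp = record
    { steps = steps sp ; path = path sp ; unique = unique sp ; v∉ = v∉ sp ; ⊆ws = λ c∈ → ⊆ (⊆ws sp c∈) }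

  open DecMembership (_≟ᶠ_ {n}) using (_∈?_)

  eraseLoops : ∀ {u v} (ws : List (Arc n)) → PathFrom u ws v → SimplePath u v ws
  eraseLoops [] refl = record { steps = [] ; path = refl ; unique = [] ; v∉ = λ () ; ⊆ws = λ () }
  eraseLoops {u} {v} (a ∷ ws) (refl , h) with eraseLoops ws h
  ... | sp with u ∈? srcs (steps sp) | u ≟ᶠ v
  ... | yes u∈ | _ = SimplePath-weaken there (SimplePath-suffix sp u∈)
  ... | no u∉ | yes refl = record { steps = [] ; path = refl ; unique = [] ; v∉ = λ () ; ⊆ws = λ () }
  ... | no u∉ | no u≢v = record
    { steps  = a ∷ steps sp
    ; path   = refl , path sp
    ; unique = ¬Any⇒All¬ _ u∉ ∷ unique sp
    ; v∉     = λ { (here v≡u) → u≢v (sym v≡u) ; (there v∈) → v∉ sp v∈ }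
    ; ⊆ws    = λ { (here refl) → here refl ; (there c∈) → there (⊆ws sp c∈) }
    }

  -- Kept abstract: only its specification is used, and unfolding the loop erasure makes
  -- type checking of the splicing arguments below prohibitively slow.
  abstract
    cycle-through : ∀ {a} (ws : List (Arc n)) → PathFrom (tgt a) ws (src a) →
                    Σ (Cycle n) λ E → a ∈ arcs E × (∀ {c} → c ∈ arcs E → c ∈ a ∷ ws)
    cycle-through {a} ws h =
      cycle (a ∷ steps sp) (λ ()) (src a) (refl , path sp) (¬Any⇒All¬ _ (v∉ sp) ∷ unique sp) ,
      here refl ,
      λ { (here refl) → here refl ; (there c∈) → there (⊆ws sp c∈) }
      where
        sp : SimplePath (tgt a) (src a) ws
        sp = eraseLoops ws h

-- Linear forms and the inequality of a cycle

module _ {n : ℕ} where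

  δ-≡ : ∀ {i j : Fin n} → i ≡ j → δ i j ≡ 1ℚ
  δ-≡ {i} {j} i≡j with i ≟ᶠ j
  ... | yes _   = refl
  ... | no i≢j = ⊥-elim (i≢j i≡j)

  δ-≢ : ∀ {i j : Fin n} → i ≢ j → δ i j ≡ 0ℚ
  δ-≢ {i} {j} i≢j with i ≟ᶠ j
  ... | yes i≡j = ⊥-elim (i≢j i≡j)
  ... | no _    = refl

δ-suc : ∀ {n} (i j : Fin n) → δ (Fin.suc i) (Fin.suc j) ≡ δ i j
δ-suc i j = by-cases (i ≟ᶠ j)
  where
    by-cases : Dec (i ≡ j) → δ (Fin.suc i) (Fin.suc j) ≡ δ i j
    by-cases (yes i≡j) = trans (δ-≡ (cong Fin.suc i≡j)) (sym (δ-≡ i≡j))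
    by-cases (no i≢j)  = trans (δ-≢ (i≢j ∘ suc-injective)) (sym (δ-≢ i≢j))

∑-δ : ∀ {n} (y : Fin n) (h : Fin n → ℚ) → ∑[ i < n ] (δ y i * h i) ≡ h y
∑-δ {suc n} Fin.zero h = begin
  1ℚ * h Fin.zero + ∑[ i < n ] (0ℚ * h (Fin.suc i))
    ≡⟨ cong (1ℚ * h Fin.zero +_) (trans (sum-cong-≗ (λ i → ℚP.*-zeroˡ (h (Fin.suc i)))) (sum-replicate-zero n)) ⟩
  1ℚ * h Fin.zero + 0ℚ
    ≡⟨ solve 1 (λ a → con 1ℚ :* a :+ con 0ℚ := a) refl (h Fin.zero) ⟩
  h Fin.zero ∎
  where open ≡-Reasoning
∑-δ {suc n} (Fin.suc y) h = begin
  0ℚ * h Fin.zero + ∑[ i < n ] (δ (Fin.suc y) (Fin.suc i) * h (Fin.suc i))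
    ≡⟨ cong (0ℚ * h Fin.zero +_) (sum-cong-≗ (λ i → cong (_* h (Fin.suc i)) (δ-suc y i))) ⟩
  0ℚ * h Fin.zero + ∑[ i < n ] (δ y i * h (Fin.suc i))
    ≡⟨ cong (0ℚ * h Fin.zero +_) (∑-δ y (h ∘ Fin.suc)) ⟩
  0ℚ * h Fin.zero + h (Fin.suc y)
    ≡⟨ solve 2 (λ a b → con 0ℚ :* a :+ b := b) refl (h Fin.zero) (h (Fin.suc y)) ⟩
  h (Fin.suc y) ∎
  where open ≡-Reasoning

∑-δ₂ : ∀ {n} (y x : Fin n) (u v : Fin n → ℚ) → ∑[ i < n ] (δ y i * u i + δ x i * v i) ≡ u y + v x
∑-δ₂ y x u v = trans (∑-distrib-+ (λ i → δ y i * u i) (λ i → δ x i * v i)) (cong₂ _+_ (∑-δ y u) (∑-δ x v))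

module Evaluation {n : ℕ} (L P : Fin n → ℚ) where

  term : Form n → Fin n → ℚ
  term f i = ℓc f i * L i + ρc f i * P i

  linear : Form n → ℚ
  linear f = ∑[ i < n ] term f i

  ev : Form n → ℚ
  ev f = linear f + cst f

  ev-⊕ : ∀ f h → ev (f ⊕ h) ≡ ev f + ev h
  ev-⊕ f h = begin
    linear (f ⊕ h) + (cst f + cst h)
      ≡⟨ cong (_+ (cst f + cst h)) (trans (sum-cong-≗ {n} distrib) (∑-distrib-+ (term f) (term h))) ⟩
    (linear f + linear h) + (cst f + cst h)
      ≡⟨ solve 4 (λ a b c d → (a :+ b) :+ (c :+ d) := (a :+ c) :+ (b :+ d)) refl
               (linear f) (linear h) (cst f) (cst h) ⟩
    ev f + ev h ∎
    where
      open ≡-Reasoning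
      distrib : ∀ i → (ℓc f i + ℓc h i) * L i + (ρc f i + ρc h i) * P i
                    ≡ (ℓc f i * L i + ρc f i * P i) + (ℓc h i * L i + ρc h i * P i)
      distrib i = solve 6 (λ a a' b b' l p → (a :+ a') :* l :+ (b :+ b') :* p
                                             := (a :* l :+ b :* p) :+ (a' :* l :+ b' :* p))
                          refl (ℓc f i) (ℓc h i) (ρc f i) (ρc h i) (L i) (P i)

  ev-zeroF : ev zeroF ≡ 0ℚ
  ev-zeroF = cong (_+ 0ℚ) (trans (sum-cong-≗ zero-terms) (sum-replicate-zero n))
    where
      zero-terms : ∀ i → 0ℚ * L i + 0ℚ * P i ≡ 0ℚ
      zero-terms i = solve 2 (λ l p → con 0ℚ :* l :+ con 0ℚ :* p := con 0ℚ) refl (L i) (P i)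

  ev-sumF : ∀ fs → All (λ f → ev f ≡ 0ℚ) fs → ev (sumF fs) ≡ 0ℚ
  ev-sumF []       []         = ev-zeroF
  ev-sumF (f ∷ fs) (ev≡ ∷ evs) = trans (ev-⊕ f (sumF fs)) (cong₂ _+_ ev≡ (ev-sumF fs evs))

  cst-determined : ∀ f h → (∀ i → ℓc f i ≡ ℓc h i) → (∀ i → ρc f i ≡ ρc h i) → ev f ≡ ev h → cst f ≡ cst h
  cst-determined f h ℓ≡ ρ≡ ev≡ = ∙-cancelˡ (linear h) (cst f) (cst h) (trans (cong (_+ cst f) (sym linear≡)) ev≡)
    where
      linear≡ : linear f ≡ linear h
      linear≡ = sum-cong-≗ (λ i → cong₂ _+_ (cong (_* L i) (ℓ≡ i)) (cong (_* P i) (ρ≡ i)))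

module _ {A : Set} where

  sumℚ-cong : ∀ {f g : A → ℚ} (as : List A) → (∀ {a} → a ∈ as → f a ≡ g a) → sumℚ (map f as) ≡ sumℚ (map g as)
  sumℚ-cong []       _ = refl
  sumℚ-cong (a ∷ as) f≡g = cong₂ _+_ (f≡g (here refl)) (sumℚ-cong as (f≡g ∘ there))

  sumℚ-+ : ∀ (f g : A → ℚ) (as : List A) → sumℚ (map (λ a → f a + g a) as) ≡ sumℚ (map f as) + sumℚ (map g as)
  sumℚ-+ f g []       = refl
  sumℚ-+ f g (a ∷ as) = trans (cong (f a + g a +_) (sumℚ-+ f g as))
    (solve 4 (λ a b c d → (a :+ b) :+ (c :+ d) := (a :+ c) :+ (b :+ d)) refl
           (f a) (g a) (sumℚ (map f as)) (sumℚ (map g as)))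

  module _ {n : ℕ} (key : A → Fin n) (f : A → ℚ) {x : Fin n} where

    sumℚ-δ-absent : ∀ as → x ∉ map key as → sumℚ (map (λ a → δ (key a) x * f a) as) ≡ 0ℚ
    sumℚ-δ-absent []       _  = refl
    sumℚ-δ-absent (a ∷ as) x∉ = begin
      δ (key a) x * f a + sumℚ (map (λ a → δ (key a) x * f a) as)
        ≡⟨ cong₂ (λ d s → d * f a + s) (δ-≢ (x∉ ∘ here ∘ sym)) (sumℚ-δ-absent as (x∉ ∘ there)) ⟩
      0ℚ * f a + 0ℚ
        ≡⟨ solve 1 (λ v → con 0ℚ :* v :+ con 0ℚ := con 0ℚ) refl (f a) ⟩
      0ℚ ∎
      where open ≡-Reasoning

    sumℚ-δ-unique : ∀ as {b} → Unique (map key as) → b ∈ as → key b ≡ x →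
                    sumℚ (map (λ a → δ (key a) x * f a) as) ≡ f b
    sumℚ-δ-unique (a ∷ as) (key-a∉ ∷ _) (here refl) refl = begin
      δ (key a) (key a) * f a + sumℚ (map (λ c → δ (key c) (key a) * f c) as)
        ≡⟨ cong₂ (λ d s → d * f a + s) (δ-≡ {i = key a} refl)
                 (sumℚ-δ-absent as (λ x∈ → All.lookup key-a∉ x∈ refl)) ⟩
      1ℚ * f a + 0ℚ
        ≡⟨ solve 1 (λ v → con 1ℚ :* v :+ con 0ℚ := v) refl (f a) ⟩
      f a ∎
      where open ≡-Reasoning
    sumℚ-δ-unique (a ∷ as) {b} (key-a∉ ∷ u) (there b∈) refl = begin
      δ (key a) (key b) * f a + sumℚ (map (λ c → δ (key c) (key b) * f c) as)
        ≡⟨ cong₂ (λ d s → d * f a + s) (δ-≢ (All.lookup key-a∉ (∈-map⁺ key b∈)))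
                 (sumℚ-δ-unique as u b∈ refl) ⟩
      0ℚ * f a + f b
        ≡⟨ solve 2 (λ v w → con 0ℚ :* v :+ w := w) refl (f a) (f b) ⟩
      f b ∎
      where open ≡-Reasoning

-- The ρ-coefficient an arc contributes at its head and at its tail; a loop's is booked at its head.
inValue outValue : Kind → ℚ
inValue blue = 0ℚ
inValue red  = 1ℚ
inValue loop = 1ℚ
outValue blue = - 1ℚ
outValue red  = 0ℚ
outValue loop = 0ℚ

zero-value⇒blue : ∀ kb ka → inValue kb + outValue ka ≡ 0ℚ → kb ≡ blue ⊎ ka ≡ blue
zero-value⇒blue blue ka   _ = inj₁ refl
zero-value⇒blue red  blue _ = inj₂ refl
zero-value⇒blue loop blue _ = inj₂ refl
zero-value⇒blue red  red  ()
zero-value⇒blue red  loop ()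
zero-value⇒blue loop red  ()
zero-value⇒blue loop loop ()

negative-value : ∀ kb ka → inValue kb + outValue ka ℚ.< 0ℚ → inValue kb ≡ 0ℚ × outValue ka ≡ - 1ℚ
negative-value blue blue _ = refl , refl
negative-value blue red  p = ⊥-elim (ℚP.<-irrefl refl p)
negative-value blue loop p = ⊥-elim (ℚP.<-irrefl refl p)
negative-value red  blue p = ⊥-elim (ℚP.<-irrefl refl p)
negative-value loop blue p = ⊥-elim (ℚP.<-irrefl refl p)
negative-value red  red  p = ⊥-elim (ℚP.<-asym p (ℚP.positive⁻¹ 1ℚ))
negative-value red  loop p = ⊥-elim (ℚP.<-asym p (ℚP.positive⁻¹ 1ℚ))
negative-value loop red  p = ⊥-elim (ℚP.<-asym p (ℚP.positive⁻¹ 1ℚ))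
negative-value loop loop p = ⊥-elim (ℚP.<-asym p (ℚP.positive⁻¹ 1ℚ))

positive-value : ∀ kb ka → 0ℚ ℚ.< inValue kb + outValue ka → inValue kb ≡ 1ℚ × outValue ka ≡ 0ℚ
positive-value red  red  _ = refl , refl
positive-value red  loop _ = refl , refl
positive-value loop red  _ = refl , refl
positive-value loop loop _ = refl , refl
positive-value blue red  p = ⊥-elim (ℚP.<-irrefl refl p)
positive-value blue loop p = ⊥-elim (ℚP.<-irrefl refl p)
positive-value red  blue p = ⊥-elim (ℚP.<-irrefl refl p)
positive-value loop blue p = ⊥-elim (ℚP.<-irrefl refl p)
positive-value blue blue p = ⊥-elim (ℚP.<-asym p (ℚP.negative⁻¹ (- 1ℚ)))

module _ {n : ℕ} where

  Proper : Arc n → Set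
  Proper a = kind a ≡ loop → src a ≡ tgt a

  IsArc⇒Proper : ∀ {_≺_ : Fin n → Fin n → Set} {ℓ r} a → IsArc _≺_ ℓ r a → Proper a
  IsArc⇒Proper (arc loop x y) (x≡y , _) _ = x≡y

  ρc-weight : ∀ a → Proper a → ∀ x →
              ρc (weight a) x ≡ δ (tgt a) x * inValue (kind a) + δ (src a) x * outValue (kind a)
  ρc-weight (arc blue s t) _ x = solve 2 (λ d e → :- e := d :* con 0ℚ :+ e :* con (- 1ℚ)) refl (δ t x) (δ s x)
  ρc-weight (arc red s t)  _ x = solve 2 (λ d e → d := d :* con 1ℚ :+ e :* con 0ℚ) refl (δ t x) (δ s x)
  ρc-weight (arc loop s t) proper x rewrite proper refl =
    solve 1 (λ d → d := d :* con 1ℚ :+ d :* con 0ℚ) refl (δ t x)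

  ℓc-weight : ∀ a → Proper a → ∀ i → ℓc (weight a) i ≡ δ (tgt a) i - δ (src a) i
  ℓc-weight (arc blue s t) _ i = refl
  ℓc-weight (arc red s t)  _ i = refl
  ℓc-weight (arc loop s t) proper i rewrite proper refl = sym (ℚP.+-inverseʳ (δ t i))

  W : List (Arc n) → Form n
  W as = sumF (map weight as)

  ρc-W : ∀ (as : List (Arc n)) x → ρc (W as) x ≡ sumℚ (map (λ a → ρc (weight a) x) as)
  ρc-W []       x = refl
  ρc-W (a ∷ as) x = cong (ρc (weight a) x +_) (ρc-W as x)

  ℓc-path : ∀ {u v} as → (∀ {c} → c ∈ as → Proper c) → PathFrom u as v → ∀ i → ℓc (W as) i ≡ δ v i - δ u i
  ℓc-path {u} []       _      refl     i = sym (ℚP.+-inverseʳ (δ u i))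
  ℓc-path {v = v} (a ∷ as) proper (refl , h) i =
    trans (cong₂ _+_ (ℓc-weight a (proper (here refl)) i) (ℓc-path as (proper ∘ there) h i))
          (solve 3 (λ x y z → (y :- x) :+ (z :- y) := z :- x) refl (δ (src a) i) (δ (tgt a) i) (δ v i))

  cst-weight-nonpos : ∀ (a : Arc n) → cst (weight a) ℚ.≤ 0ℚ
  cst-weight-nonpos (arc blue _ _) = ℚP.<⇒≤ (ℚP.negative⁻¹ (- 1ℚ))
  cst-weight-nonpos (arc red _ _)  = ℚP.≤-refl
  cst-weight-nonpos (arc loop _ _) = ℚP.≤-refl

  cst-W-nonpos : ∀ (as : List (Arc n)) → cst (W as) ℚ.≤ 0ℚ
  cst-W-nonpos []       = ℚP.≤-refl
  cst-W-nonpos (a ∷ as) = ℚP.+-mono-≤ {_} {0ℚ} {_} {0ℚ} (cst-weight-nonpos a) (cst-W-nonpos as)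

  cst-W-negative : ∀ (as : List (Arc n)) {b} → b ∈ as → kind b ≡ blue → cst (W as) ℚ.< 0ℚ
  cst-W-negative (arc red _ _ ∷ as)  (here refl) ()
  cst-W-negative (arc loop _ _ ∷ as) (here refl) ()
  cst-W-negative (arc blue _ _ ∷ as) (here refl) _ =
    ℚP.+-mono-<-≤ {_} {0ℚ} {_} {0ℚ} (ℚP.negative⁻¹ (- 1ℚ)) (cst-W-nonpos as)
  cst-W-negative (a ∷ as) (there b∈) b-blue =
    ℚP.+-mono-≤-< {_} {0ℚ} {_} {0ℚ} (cst-weight-nonpos a) (cst-W-negative as b∈ b-blue)

  module _ (E : Cycle n) (proper : ∀ {c} → c ∈ arcs E → Proper c) where

    private
      in-term out-term : Fin n → Arc n → ℚ
      in-term x c = δ (tgt c) x * inValue (kind c)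
      out-term x c = δ (src c) x * outValue (kind c)

      ρc-Wcyc : ∀ x → ρc (Wcyc E) x ≡ sumℚ (map (in-term x) (arcs E)) + sumℚ (map (out-term x) (arcs E))
      ρc-Wcyc x = trans (ρc-W (arcs E) x)
                  (trans (sumℚ-cong (arcs E) (λ c∈ → ρc-weight _ (proper c∈) x))
                         (sumℚ-+ (in-term x) (out-term x) (arcs E)))

    ρc-cycle : ∀ {x a b} → b ∈ arcs E → tgt b ≡ x → a ∈ arcs E → src a ≡ x →
               ρc (Wcyc E) x ≡ inValue (kind b) + outValue (kind a)
    ρc-cycle {x} b∈ b→x a∈ a←x = trans (ρc-Wcyc x)
      (cong₂ _+_ (sumℚ-δ-unique tgt (inValue ∘ kind) (arcs E) (unique-tgts E) b∈ b→x)
                 (sumℚ-δ-unique src (outValue ∘ kind) (arcs E) (simple E) a∈ a←x))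

    ρc-cycle-outside : ∀ {x} → x ∉ vertices E → ρc (Wcyc E) x ≡ 0ℚ
    ρc-cycle-outside {x} x∉ = trans (ρc-Wcyc x)
      (cong₂ _+_ (sumℚ-δ-absent tgt (inValue ∘ kind) (arcs E) (x∉ ∘ ∈-resp-↭ (tgts↭vertices E)))
                 (sumℚ-δ-absent src (outValue ∘ kind) (arcs E) x∉))

    ℓc-cycle : ∀ i → ℓc (Wcyc E) i ≡ 0ℚ
    ℓc-cycle i = trans (ℓc-path (arcs E) proper (closed E) i) (ℚP.+-inverseʳ (δ (start E) i))

module _ {c : ℚ} (c>0 : 0ℚ ℚ.< c) where

  private instance
    c-positive : ℚ.Positive c
    c-positive = ℚ.positive c>0

  *-negative : ∀ {u} → u ℚ.< 0ℚ → c * u ℚ.< 0ℚ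
  *-negative u<0 = ℚP.negative⁻¹ _ {{ℚP.pos*neg⇒neg c _ {{ℚ.negative u<0}}}}

  *-positive : ∀ {u} → 0ℚ ℚ.< u → 0ℚ ℚ.< c * u
  *-positive u>0 = ℚP.positive⁻¹ _ {{ℚP.pos*pos⇒pos c _ {{ℚ.positive u>0}}}}

  *-zero⇔ : ∀ {u} → c * u ≡ 0ℚ ⇔ u ≡ 0ℚ
  *-zero⇔ {u} = mk⇔ cancel (λ u≡0 → trans (cong (c *_) u≡0) (ℚP.*-zeroʳ c))
    where
      cancel : c * u ≡ 0ℚ → u ≡ 0ℚ
      cancel cu≡0 with ℚP.<-cmp u 0ℚ
      ... | tri< u<0 _ _ = ⊥-elim (ℚP.<-irrefl cu≡0 (*-negative u<0))
      ... | tri≈ _ u≡0 _ = u≡0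
      ... | tri> _ _ u>0 = ⊥-elim (ℚP.<-irrefl (sym cu≡0) (*-positive u>0))

module _ {n : ℕ} where

  ≈ᶠ-ρc : ∀ {f h : Form n} (f≈h : f ≈ᶠ h) x → ρc f x ≡ proj₁ f≈h * ρc h x
  ≈ᶠ-ρc (_ , _ , _ , ρ≈ , _) = ρ≈

  ≈ᶠ⇒ρc-zero⇔ : ∀ {f h : Form n} → f ≈ᶠ h → ∀ x → ρc f x ≡ 0ℚ ⇔ ρc h x ≡ 0ℚ
  ≈ᶠ⇒ρc-zero⇔ (c , c>0 , _ , ρ≈ , _) x =
    mk⇔ (to (*-zero⇔ c>0) ∘ trans (sym (ρ≈ x))) (trans (ρ≈ x) ∘ from (*-zero⇔ c>0))

  _≗ᶠ_ : Form n → Form n → Set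
  f ≗ᶠ h = (∀ i → ℓc f i ≡ ℓc h i) × (∀ i → ρc f i ≡ ρc h i) × cst f ≡ cst h

  ≗ᶠ-≈ᶠ-trans : ∀ {f f' h : Form n} → f ≗ᶠ f' → f' ≈ᶠ h → f ≈ᶠ h
  ≗ᶠ-≈ᶠ-trans (ℓ≡ , ρ≡ , cst≡) (c , c>0 , ℓ≈ , ρ≈ , cst≈) =
    c , c>0 , (λ i → trans (ℓ≡ i) (ℓ≈ i)) , (λ i → trans (ρ≡ i) (ρ≈ i)) , trans cst≡ cst≈

fromℕ : ℕ → ℚ
fromℕ zero    = 0ℚ
fromℕ (suc m) = 1ℚ + fromℕ m

module AtRepresentation {n : ℕ} (_≺_ : Fin n → Fin n → Set) (ℓ r : Fin n → ℕ) where

  private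
    L R P : Fin n → ℚ
    L i = fromℕ (ℓ i)
    R i = fromℕ (r i)
    P i = R i - L i

  open Evaluation L P public

  -- The arcs are the slack-zero pairs, so at ℓ and ρ = r - ℓ every arc inequality holds with equality.
  ev-weight : ∀ a → IsArc _≺_ ℓ r a → ev (weight a) ≡ 0ℚ
  ev-weight (arc blue x y) (_ , ℓy≡1+rx) = begin
    linear (weight (arc blue x y)) + - 1ℚ
      ≡⟨ cong (_+ - 1ℚ) (trans (sum-cong-≗ {n} regroup) (∑-δ₂ y x L (λ i → - (L i + P i)))) ⟩
    fromℕ (ℓ y) + - (L x + P x) + - 1ℚ
      ≡⟨ cong (λ m → fromℕ m + - (L x + P x) + - 1ℚ) ℓy≡1+rx ⟩
    1ℚ + R x + - (L x + (R x - L x)) + - 1ℚ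
      ≡⟨ solve 2 (λ u v → con 1ℚ :+ u :+ :- (v :+ (u :- v)) :+ :- con 1ℚ := con 0ℚ) refl (R x) (L x) ⟩
    0ℚ ∎
    where
      open ≡-Reasoning
      regroup : ∀ i → (δ y i - δ x i) * L i + (- δ x i) * P i ≡ δ y i * L i + δ x i * - (L i + P i)
      regroup i = solve 4 (λ d e l p → (d :- e) :* l :+ (:- e) :* p := d :* l :+ e :* (:- (l :+ p))) refl
                          (δ y i) (δ x i) (L i) (P i)
  ev-weight (arc red x y) (_ , ry≡ℓx) = begin
    linear (weight (arc red x y)) + 0ℚ
      ≡⟨ cong (_+ 0ℚ) (trans (sum-cong-≗ {n} regroup) (∑-δ₂ y x (λ i → L i + P i) (λ i → - L i))) ⟩
    L y + (fromℕ (r y) - L y) + - L x + 0ℚ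
      ≡⟨ cong (λ m → L y + (fromℕ m - L y) + - L x + 0ℚ) ry≡ℓx ⟩
    L y + (L x - L y) + - L x + 0ℚ
      ≡⟨ solve 2 (λ u v → u :+ (v :- u) :+ :- v :+ con 0ℚ := con 0ℚ) refl (L y) (L x) ⟩
    0ℚ ∎
    where
      open ≡-Reasoning
      regroup : ∀ i → (δ y i - δ x i) * L i + δ y i * P i ≡ δ y i * (L i + P i) + δ x i * - L i
      regroup i = solve 4 (λ d e l p → (d :- e) :* l :+ d :* p := d :* (l :+ p) :+ e :* (:- l)) refl
                          (δ y i) (δ x i) (L i) (P i)
  ev-weight (arc loop x y) (_ , rx≡ℓx) = begin
    linear (weight (arc loop x y)) + 0ℚ
      ≡⟨ cong (_+ 0ℚ) (trans (sum-cong-≗ {n} regroup) (∑-δ₂ x x P (λ _ → 0ℚ))) ⟩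
    fromℕ (r x) - L x + 0ℚ + 0ℚ
      ≡⟨ cong (λ m → fromℕ m - L x + 0ℚ + 0ℚ) rx≡ℓx ⟩
    L x - L x + 0ℚ + 0ℚ
      ≡⟨ solve 1 (λ u → u :- u :+ con 0ℚ :+ con 0ℚ := con 0ℚ) refl (L x) ⟩
    0ℚ ∎
    where
      open ≡-Reasoning
      regroup : ∀ i → 0ℚ * L i + δ x i * P i ≡ δ x i * P i + δ x i * 0ℚ
      regroup i = solve 3 (λ e l p → con 0ℚ :* l :+ e :* p := e :* p :+ e :* con 0ℚ) refl (δ x i) (L i) (P i)

  ev-W : ∀ as → (∀ {c} → c ∈ as → IsArc _≺_ ℓ r c) → ev (W as) ≡ 0ℚ
  ev-W as isArc = ev-sumF (map weight as) (map⁺ (All.tabulate (λ c∈ → ev-weight _ (isArc c∈))))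

  InKeyGraph : Cycle n → Set
  InKeyGraph E = ∀ {c} → c ∈ arcs E → IsArc _≺_ ℓ r c

  InKeyGraph⇒Proper : ∀ E → InKeyGraph E → ∀ {c} → c ∈ arcs E → Proper c
  InKeyGraph⇒Proper E isArc c∈ = IsArc⇒Proper _ (isArc c∈)

  cycle-form-determined : ∀ {E E'} → InKeyGraph E → InKeyGraph E' →
                          (∀ x → ρc (Wcyc E) x ≡ ρc (Wcyc E') x) → Wcyc E ≗ᶠ Wcyc E'
  cycle-form-determined {E} {E'} isArc isArc' ρ≡ =
    ℓ≡ , ρ≡ , cst-determined (Wcyc E) (Wcyc E') ℓ≡ ρ≡ (trans (ev-W (arcs E) isArc) (sym (ev-W (arcs E') isArc')))
    where
      ℓ≡ : ∀ i → ℓc (Wcyc E) i ≡ ℓc (Wcyc E') i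
      ℓ≡ i = trans (ℓc-cycle E (InKeyGraph⇒Proper E isArc) i) (sym (ℓc-cycle E' (InKeyGraph⇒Proper E' isArc') i))

  -- A cycle with ρ-part zero would have constant 0, hence no blue arc; but then every vertex gets ρ-coefficient 1.
  cycle-ρ-nonzero : ∀ {E} → InKeyGraph E → ¬ (∀ x → ρc (Wcyc E) x ≡ 0ℚ)
  cycle-ρ-nonzero {E} isArc ρ≡0 with some-member (arcs E) (nonempty E)
  ... | a , a∈ with in-arc E (∈-map⁺ src a∈)
  ... | b , b∈ , b→a = ℚP.<-irrefl cst≡0 (has-blue (zero-value⇒blue (kind b) (kind a) value≡0))
    where
      cst≡0 : cst (Wcyc E) ≡ 0ℚ
      cst≡0 = cst-determined (Wcyc E) zeroF (ℓc-cycle E (InKeyGraph⇒Proper E isArc)) ρ≡0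
                             (trans (ev-W (arcs E) isArc) (sym ev-zeroF))
      value≡0 : inValue (kind b) + outValue (kind a) ≡ 0ℚ
      value≡0 = trans (sym (ρc-cycle E (InKeyGraph⇒Proper E isArc) b∈ b→a a∈ refl)) (ρ≡0 (src a))
      has-blue : kind b ≡ blue ⊎ kind a ≡ blue → cst (Wcyc E) ℚ.< 0ℚ
      has-blue (inj₁ b-blue) = cst-W-negative (arcs E) b∈ b-blue
      has-blue (inj₂ a-blue) = cst-W-negative (arcs E) a∈ a-blue

-- Cycles in a union of concordant cycles

another-index : ∀ {t} → 2 ≤ t → (j : Fin t) → ∃ (j ≢_)
another-index (s≤s (s≤s _)) Fin.zero    = Fin.suc Fin.zero , λ ()
another-index (s≤s (s≤s _)) (Fin.suc _) = Fin.zero , λ ()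

module ConcordantFamily {n : ℕ} (_≺_ : Fin n → Fin n → Set) (ℓ r : Fin n → ℕ)
  (g : Arc n → ℚ) (circulation : IsCirculation _≺_ ℓ r g)
  {t : ℕ} (t≥2 : 2 ≤ t) (C : Fin t → Cycle n)
  (concordant : ∀ i → Concordant g (C i))
  (pairwise : ∀ i j → i < j → ¬ (Σ (Cycle n) λ D → All (λ a → a ∈ arcs (C i) ⊎ a ∈ arcs (C j)) (arcs D) × Discordant g D))
  where

  open AtRepresentation _≺_ ℓ r
  open DecMembership (_≟ᶠ_ {n}) using (_∈?_)

  -- K = {x | q x ≢ 0ℚ} is the common support of the ρ-parts of all concordant cycles.
  q : Fin n → ℚ
  q = ρc (Wcirc g)

  i₀ : Fin t
  i₀ = Fin.fromℕ< t≥2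

  ν : Fin n → ℚ
  ν = ρc (Wcyc (C i₀))

  supp⇒InKeyGraph : ∀ {E} → InSupp g E → InKeyGraph E
  supp⇒InKeyGraph E-supp c∈ = proj₁ (proj₂ circulation) _ (All.lookup E-supp c∈)

  C-supp : ∀ j {c} → c ∈ arcs (C j) → g c ≢ 0ℚ
  C-supp j = All.lookup (proj₁ (concordant j))

  C-key : ∀ j → InKeyGraph (C j)
  C-key j = supp⇒InKeyGraph {C j} (proj₁ (concordant j))

  C-proper : ∀ j {c} → c ∈ arcs (C j) → Proper c
  C-proper j = InKeyGraph⇒Proper (C j) (C-key j)

  C-zero⇔ : ∀ j x → ρc (Wcyc (C j)) x ≡ 0ℚ ⇔ q x ≡ 0ℚ
  C-zero⇔ j = ≈ᶠ⇒ρc-zero⇔ (proj₂ (concordant j))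

  ν-zero : ∀ {x} → q x ≡ 0ℚ → ν x ≡ 0ℚ
  ν-zero = from (C-zero⇔ i₀ _)

  K⊆C : ∀ j {x} → q x ≢ 0ℚ → x ∈ vertices (C j)
  K⊆C j {x} qx≢0 = decidable-stable (x ∈? vertices (C j))
    (λ x∉ → qx≢0 (to (C-zero⇔ j x) (ρc-cycle-outside (C j) (C-proper j) x∉)))

  K-nonempty : ∃ λ z → q z ≢ 0ℚ
  K-nonempty = ¬∀⟶∃¬ n (λ x → q x ≡ 0ℚ) (λ x → q x ℚP.≟ 0ℚ)
    (λ q≡0 → cycle-ρ-nonzero {C i₀} (C-key i₀) (λ x → from (C-zero⇔ i₀ x) (q≡0 x)))

  InUnion : Fin t → Fin t → Cycle n → Set
  InUnion j k E = ∀ {c} → c ∈ arcs E → c ∈ arcs (C j) ⊎ c ∈ arcs (C k)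

  distinct-union-not-discordant : ∀ {j k E} → j ≢ k → InUnion j k E → ¬ ¬ (Wcyc E ≈ᶠ Wcirc g)
  distinct-union-not-discordant {j} {k} {E} j≢k sub ¬E≈g = by-order (<-cmp j k)
    where
      supp : InSupp g E
      supp = All.tabulate λ c∈ → [ C-supp j , C-supp k ]′ (sub c∈)
      by-order : Tri (j < k) (j ≡ k) (k < j) → ⊥
      by-order (tri< j<k _ _) = pairwise j k j<k (E , All.tabulate sub , supp , ¬E≈g)
      by-order (tri≈ _ j≡k _) = j≢k j≡k
      by-order (tri> _ _ k<j) = pairwise k j k<j (E , All.tabulate (swap ∘ sub) , supp , ¬E≈g)

  union-not-discordant : ∀ {j k E} → InUnion j k E → ¬ ¬ (Wcyc E ≈ᶠ Wcirc g)
  union-not-discordant {j} {k} {E} sub = by-equality (j ≟ᶠ k)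
    where
      by-equality : Dec (j ≡ k) → ¬ ¬ (Wcyc E ≈ᶠ Wcirc g)
      by-equality (no j≢k)  = distinct-union-not-discordant {j} {k} {E} j≢k sub
      by-equality (yes j≡k) = let (k' , j≢k') = another-index t≥2 j in
        distinct-union-not-discordant {j} {k'} {E} j≢k'
          (inj₁ ∘ reduce ∘ Sum.map₂ (subst (λ i → _ ∈ arcs (C i)) (sym j≡k)) ∘ sub)

  union-ρ-zero : ∀ {j k E x} → InUnion j k E → q x ≡ 0ℚ → ρc (Wcyc E) x ≡ 0ℚ
  union-ρ-zero {j} {k} {E} {x} sub qx≡0 = decidable-stable (ρc (Wcyc E) x ℚP.≟ 0ℚ)
    (λ ρ≢0 → union-not-discordant {j} {k} {E} sub
      (λ E≈g → ρ≢0 (from (≈ᶠ⇒ρc-zero⇔ {f = Wcyc E} E≈g x) qx≡0)))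

  union-covers-K : ∀ {j k E x} → InUnion j k E → q x ≢ 0ℚ → x ∈ vertices E
  union-covers-K {j} {k} {E} {x} sub qx≢0 = decidable-stable (x ∈? vertices E)
    (λ x∉ → union-not-discordant {j} {k} {E} sub (λ E≈g →
      qx≢0 (to (≈ᶠ⇒ρc-zero⇔ {f = Wcyc E} E≈g x) (ρc-cycle-outside E (InKeyGraph⇒Proper E key) x∉))))
    where
      key : InKeyGraph E
      key c∈ = [ C-key j , C-key k ]′ (sub c∈)

  scale : Fin t → ℚ
  scale j = proj₁ (proj₂ (concordant j))

  scale>0 : ∀ j → 0ℚ ℚ.< scale j
  scale>0 j = proj₁ (proj₂ (proj₂ (concordant j)))

  value-scaled : ∀ j {x a b} → b ∈ arcs (C j) → tgt b ≡ x → a ∈ arcs (C j) → src a ≡ x →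
                 inValue (kind b) + outValue (kind a) ≡ scale j * q x
  value-scaled j {x} b∈ b→x a∈ a←x =
    trans (sym (ρc-cycle (C j) (C-proper j) b∈ b→x a∈ a←x)) (≈ᶠ-ρc (proj₂ (concordant j)) x)

  in-vertex : ∀ j {x b} → b ∈ arcs (C j) → tgt b ≡ x → x ∈ vertices (C j)
  in-vertex j b∈ refl = tgt∈vertices (C j) b∈

  out-vertex : ∀ j {x a} → a ∈ arcs (C j) → src a ≡ x → x ∈ vertices (C j)
  out-vertex j a∈ refl = ∈-map⁺ src a∈

  module _ {x : Fin n} where

    by-sign : ∀ {A : Set} → q x ≢ 0ℚ → (q x ℚ.< 0ℚ → A) → (0ℚ ℚ.< q x → A) → A
    by-sign {A} qx≢0 neg pos = by-order (ℚP.<-cmp (q x) 0ℚ)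
      where
        by-order : Tri (q x ℚ.< 0ℚ) (q x ≡ 0ℚ) (0ℚ ℚ.< q x) → A
        by-order (tri< qx<0 _ _) = neg qx<0
        by-order (tri≈ _ qx≡0 _) = ⊥-elim (qx≢0 qx≡0)
        by-order (tri> _ _ qx>0) = pos qx>0

    incidence-negative : ∀ j {a b} → b ∈ arcs (C j) → tgt b ≡ x → a ∈ arcs (C j) → src a ≡ x →
                         q x ℚ.< 0ℚ → inValue (kind b) ≡ 0ℚ × outValue (kind a) ≡ - 1ℚ
    incidence-negative j {a} {b} b∈ b→x a∈ a←x qx<0 = negative-value (kind b) (kind a)
      (subst (ℚ._< 0ℚ) (sym (value-scaled j b∈ b→x a∈ a←x)) (*-negative (scale>0 j) qx<0))

    incidence-positive : ∀ j {a b} → b ∈ arcs (C j) → tgt b ≡ x → a ∈ arcs (C j) → src a ≡ x →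
                         0ℚ ℚ.< q x → inValue (kind b) ≡ 1ℚ × outValue (kind a) ≡ 0ℚ
    incidence-positive j {a} {b} b∈ b→x a∈ a←x qx>0 = positive-value (kind b) (kind a)
      (subst (0ℚ ℚ.<_) (sym (value-scaled j b∈ b→x a∈ a←x)) (*-positive (scale>0 j) qx>0))

    in-uniform : ∀ {j j' b b'} → q x ≢ 0ℚ → b ∈ arcs (C j) → tgt b ≡ x → b' ∈ arcs (C j') → tgt b' ≡ x →
                 inValue (kind b) ≡ inValue (kind b')
    in-uniform {j} {j'} qx≢0 b∈ b→x b'∈ b'→x =
      let (a , a∈ , a←x) = out-arc (C j) (in-vertex j b∈ b→x)
          (a' , a'∈ , a'←x) = out-arc (C j') (in-vertex j' b'∈ b'→x)
      in by-sign qx≢0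
        (λ qx<0 → trans (proj₁ (incidence-negative j b∈ b→x a∈ a←x qx<0))
                        (sym (proj₁ (incidence-negative j' b'∈ b'→x a'∈ a'←x qx<0))))
        (λ qx>0 → trans (proj₁ (incidence-positive j b∈ b→x a∈ a←x qx>0))
                        (sym (proj₁ (incidence-positive j' b'∈ b'→x a'∈ a'←x qx>0))))

    out-uniform : ∀ {j j' a a'} → q x ≢ 0ℚ → a ∈ arcs (C j) → src a ≡ x → a' ∈ arcs (C j') → src a' ≡ x →
                  outValue (kind a) ≡ outValue (kind a')
    out-uniform {j} {j'} qx≢0 a∈ a←x a'∈ a'←x =
      let (b , b∈ , b→x) = in-arc (C j) (out-vertex j a∈ a←x)
          (b' , b'∈ , b'→x) = in-arc (C j') (out-vertex j' a'∈ a'←x)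
      in by-sign qx≢0
        (λ qx<0 → trans (proj₂ (incidence-negative j b∈ b→x a∈ a←x qx<0))
                        (sym (proj₂ (incidence-negative j' b'∈ b'→x a'∈ a'←x qx<0))))
        (λ qx>0 → trans (proj₂ (incidence-positive j b∈ b→x a∈ a←x qx>0))
                        (sym (proj₂ (incidence-positive j' b'∈ b'→x a'∈ a'←x qx>0))))

    value-in-K : ∀ {j k a b} → q x ≢ 0ℚ → b ∈ arcs (C j) → tgt b ≡ x → a ∈ arcs (C k) → src a ≡ x →
                 inValue (kind b) + outValue (kind a) ≡ ν x
    value-in-K qx≢0 b∈ b→x a∈ a←x =
      let (b₀ , b₀∈ , b₀→x) = in-arc (C i₀) (K⊆C i₀ qx≢0)
          (a₀ , a₀∈ , a₀←x) = out-arc (C i₀) (K⊆C i₀ qx≢0)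
      in trans (cong₂ _+_ (in-uniform qx≢0 b∈ b→x b₀∈ b₀→x) (out-uniform qx≢0 a∈ a←x a₀∈ a₀←x))
            (sym (ρc-cycle (C i₀) (C-proper i₀) b₀∈ b₀→x a₀∈ a₀←x))

  module Rooted {z : Fin n} (z∈K : q z ≢ 0ℚ) where

    private
      root : ∀ j → ∃ λ a → a ∈ arcs (C j) × src a ≡ z
      root j = out-arc (C j) (K⊆C j z∈K)

      rotation : ∀ j → Rotation (C j) (proj₁ (root j))
      rotation j = rotate (C j) (proj₁ (proj₂ (root j)))

    tour : Fin t → List (Arc n)
    tour j = proj₁ (root j) ∷ Rotation.rest (rotation j)

    tour-path : ∀ j → PathFrom z (tour j) z
    tour-path j = subst (λ v → PathFrom v (tour j) v) (proj₂ (proj₂ (root j))) (Rotation.path (rotation j))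

    tour-unique : ∀ j → Unique (srcs (tour j))
    tour-unique j = Rotation.unique (rotation j)

    C⊆tour : ∀ j {c} → c ∈ arcs (C j) → c ∈ tour j
    C⊆tour j = Rotation.∈⁺ (rotation j)

    tour⊆C : ∀ j {c} → c ∈ tour j → c ∈ arcs (C j)
    tour⊆C j = Rotation.∈⁻ (rotation j)

    record Cut (j : Fin t) (x : Fin n) : Set where
      field
        out    : Arc n
        out∈   : out ∈ arcs (C j)
        out←x  : src out ≡ x
        pieces : Split z (tour j) z out

      open Split pieces public

      srcs-at : srcs (tour j) ≡ srcs pre ++ x ∷ srcs suf
      srcs-at = subst (λ v → srcs (tour j) ≡ srcs pre ++ v ∷ srcs suf) out←x srcs≡

      pre⊆C : ∀ {c} → c ∈ pre → c ∈ arcs (C j)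
      pre⊆C c∈ = tour⊆C j (subst (_ ∈_) (sym as≡) (∈-++⁺ˡ c∈))

      rest⊆C : ∀ {c} → c ∈ out ∷ suf → c ∈ arcs (C j)
      rest⊆C c∈ = tour⊆C j (subst (_ ∈_) (sym as≡) (∈-++⁺ʳ pre c∈))

      x∉suf : x ∉ srcs suf
      x∉suf = Unique[x∷xs]⇒x∉xs (Unique-++⁻ʳ (srcs pre) (subst Unique srcs-at (tour-unique j)))

    cut : ∀ j {x} → x ∈ vertices (C j) → Cut j x
    cut j x∈ =
      let (a , a∈ , a←x) = out-arc (C j) x∈
      in record { out = a ; out∈ = a∈ ; out←x = a←x ; pieces = split (tour-path j) (C⊆tour j a∈) }

    -- Follow C k from x to the root z, then C j from z back to x.
    module Splice {x} (x≢z : x ≢ z) {j k : Fin t} (Cj : Cut j x) (Ck : Cut k x) where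

      open Cut

      private
        spliced : Σ (Cycle n) λ E → out Ck ∈ arcs E × (∀ {c} → c ∈ arcs E → c ∈ out Ck ∷ suf Ck ++ pre Cj)
        spliced = cycle-through (suf Ck ++ pre Cj)
          (path-++⁺ (suf Ck) (suf-path Ck) (subst (PathFrom z (pre Cj)) (trans (out←x Cj) (sym (out←x Ck))) (pre-path Cj)))

      E : Cycle n
      E = proj₁ spliced

      out∈E : out Ck ∈ arcs E
      out∈E = proj₁ (proj₂ spliced)

      private
        E⊆ : ∀ {c} → c ∈ arcs E → c ∈ out Ck ∷ suf Ck ⊎ c ∈ pre Cj
        E⊆ c∈ = ∈-++⁻ (out Ck ∷ suf Ck) (proj₂ (proj₂ spliced) c∈)

      E-union : InUnion j k E
      E-union c∈ = [ inj₂ ∘ rest⊆C Ck , inj₁ ∘ pre⊆C Cj ]′ (E⊆ c∈)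

      E-proper : ∀ {c} → c ∈ arcs E → Proper c
      E-proper c∈ = [ C-proper j , C-proper k ]′ (E-union c∈)

      E-src : ∀ {c} → c ∈ arcs E → src c ∈ x ∷ srcs (suf Ck) ⊎ src c ∈ srcs (pre Cj)
      E-src {c} c∈ = Sum.map (subst (λ v → src c ∈ v ∷ srcs (suf Ck)) (out←x Ck) ∘ ∈-map⁺ src) (∈-map⁺ src) (E⊆ c∈)

      E-in-arc : ∀ {b} → b ∈ arcs E → tgt b ≡ x → b ∈ pre Cj
      E-in-arc b∈ b→x = [ (λ b∈rest → ⊥-elim (back-at-x (tgt-later (out←x Ck , suf-path Ck) b∈rest))) , id ]′ (E⊆ b∈)
        where
          back-at-x : _ ∈ srcs (suf Ck) ⊎ _ ≡ z → ⊥
          back-at-x = [ x∉suf Ck ∘ subst (_∈ srcs (suf Ck)) b→x , x≢z ∘ trans (sym b→x) ]′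

      -- E runs through y ∈ K, and y cannot lie on the part of C k after x.
      K-before : ∀ {y} → q y ≢ 0ℚ → y ∈ srcs (pre Ck) → y ∈ srcs (pre Cj)
      K-before {y} y∈K y∈preCk =
        let (c , c∈ , y≡src) = ∈-map⁻ src (union-covers-K {j} {k} {E} E-union y∈K)
        in [ after-x , id ]′ (subst (λ v → v ∈ x ∷ srcs (suf Ck) ⊎ v ∈ srcs (pre Cj)) (sym y≡src) (E-src c∈))
        where
          after-x : y ∈ x ∷ srcs (suf Ck) → y ∈ srcs (pre Cj)
          after-x y∈ = ⊥-elim (Unique-++⇒Disjoint (subst Unique (srcs-at Ck) (tour-unique k)) (y∈preCk , y∈))

      ρ-at-x : ∀ {a b} → b ∈ arcs (C j) → tgt b ≡ x → a ∈ arcs (C k) → src a ≡ x →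
               ρc (Wcyc E) x ≡ inValue (kind b) + outValue (kind a)
      ρ-at-x {a} {b} b∈ b→x a∈ a←x = ρc-cycle E E-proper b∈E b→x a∈E a←x
        where
          a∈E : a ∈ arcs E
          a∈E = subst (_∈ arcs E) (Unique-map⇒injective src (simple (C k)) (out∈ Ck) a∈ (trans (out←x Ck) (sym a←x))) out∈E
          b∈E : b ∈ arcs E
          b∈E = let (b' , b'∈ , b'→a) = in-arc E (∈-map⁺ src a∈E) in subst (_∈ arcs E)
            (Unique-map⇒injective tgt (unique-tgts (C j)) (pre⊆C Cj (E-in-arc b'∈ (trans b'→a a←x))) b∈
                                  (trans b'→a (trans a←x (sym b→x)))) b'∈

    value-outside-K : ∀ {j k x a b} → q x ≡ 0ℚ → b ∈ arcs (C j) → tgt b ≡ x → a ∈ arcs (C k) → src a ≡ x →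
                      inValue (kind b) + outValue (kind a) ≡ 0ℚ
    value-outside-K {j} {k} {x} qx≡0 b∈ b→x a∈ a←x =
      trans (sym (ρ-at-x b∈ b→x a∈ a←x)) (union-ρ-zero {j} {k} {E} E-union qx≡0)
      where
        x≢z : x ≢ z
        x≢z refl = z∈K qx≡0
        open Splice x≢z (cut j (in-vertex j b∈ b→x)) (cut k (out-vertex k a∈ a←x))

    _≺[_]_ : Fin n → Fin t → Fin n → Set
    y ≺[ j ] x = Precedes y x (srcs (tour j))

    ≺-irrefl : ∀ j {x} → ¬ x ≺[ j ] x
    ≺-irrefl j = Precedes-irrefl (tour-unique j)

    ≺-vertex : ∀ {j x y} → y ≺[ j ] x → x ∈ vertices (C j)
    ≺-vertex {j} (us , _ , srcs≡ , _) =
      let (c , c∈ , x≡src) = ∈-map⁻ src (subst (_ ∈_) (sym srcs≡) (∈-++⁺ʳ us (here refl)))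
      in subst (_∈ vertices (C j)) (sym x≡src) (∈-map⁺ src (tour⊆C j c∈))

    ≺-next : ∀ j {y c} → c ∈ arcs (C j) → tgt c ≢ z → y ≺[ j ] src c ⊎ y ≡ src c → y ≺[ j ] tgt c
    ≺-next j c∈ tgt≢z y≼ =
      let (_ , _ , srcs≡) = consecutive (tour-path j) (C⊆tour j c∈) tgt≢z
      in Precedes-next (tour-unique j) srcs≡ y≼

    ≺-transfer : ∀ {j l x y} → x ≢ z → x ∈ vertices (C j) → q y ≢ 0ℚ → y ≺[ l ] x → y ≺[ j ] x
    ≺-transfer {j} {l} {x} {y} x≢z x∈Cj y∈K y≺x =
      srcs (Cut.pre Cj) , srcs (Cut.suf Cj) , Cut.srcs-at Cj ,
      Splice.K-before x≢z Cj Cl y∈K (Precedes⇒∈prefix (tour-unique l) (Cut.srcs-at Cl) y≺x)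
      where
        Cj : Cut j x
        Cj = cut j x∈Cj
        Cl : Cut l x
        Cl = cut l (≺-vertex y≺x)

    module Avoiding (D : Cycle n) (D⊆C : ∀ {c} → c ∈ arcs D → ∃ λ j → c ∈ arcs (C j)) (z∉D : z ∉ vertices D) where

      Reached : Fin n → Fin n → Set
      Reached y w = ∀ j → w ∈ vertices (C j) → y ≺[ j ] w

      step : ∀ {y c} → q y ≢ 0ℚ → c ∈ arcs D → y ≡ src c ⊎ Reached y (src c) → Reached y (tgt c)
      step {y} {c} y∈K c∈D y≼ l tgt∈Cl =
        let (j , c∈Cj) = D⊆C c∈D
            tgt≢z = z∉D ∘ λ tgt≡z → subst (_∈ vertices D) tgt≡z (tgt∈vertices D c∈D)
            y≼src = Sum.map (λ reached → reached j (∈-map⁺ src c∈Cj)) id (swap y≼)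
        in ≺-transfer tgt≢z tgt∈Cl y∈K (≺-next j c∈Cj tgt≢z y≼src)

      walk : ∀ {y u v c} ps → q y ≢ 0ℚ → PathFrom u (c ∷ ps) v → (∀ {c'} → c' ∈ c ∷ ps → c' ∈ arcs D) →
             y ≡ u ⊎ Reached y u → Reached y v
      walk []        y∈K (refl , refl) ⊆D y≼ = step y∈K (⊆D (here refl)) y≼
      walk (c' ∷ ps) y∈K (refl , h)    ⊆D y≼ = walk ps y∈K h (⊆D ∘ there) (inj₂ (step y∈K (⊆D (here refl)) y≼))

      -- Going once around D from y ∈ K would force y to precede itself on the tour of C i₀.
      K-avoids : ∀ {y} → q y ≢ 0ℚ → y ∉ vertices D
      K-avoids {y} y∈K y∈D =
        let (a , a∈ , a←y) = out-arc D y∈D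
            rot = rotate D a∈
            reached = walk (Rotation.rest rot) y∈K (Rotation.path rot) (Rotation.∈⁻ rot) (inj₁ (sym a←y))
            src-a∈C₀ = subst (_∈ vertices (C i₀)) (sym a←y) (K⊆C i₀ y∈K)
        in ≺-irrefl i₀ (subst (λ v → y ≺[ i₀ ] v) a←y (reached i₀ src-a∈C₀))

  mixed-value : ∀ {j k x a b} → b ∈ arcs (C j) → tgt b ≡ x → a ∈ arcs (C k) → src a ≡ x →
                inValue (kind b) + outValue (kind a) ≡ ν x
  mixed-value {x = x} {a} {b} b∈ b→x a∈ a←x = by-zero (q x ℚP.≟ 0ℚ)
    where
      by-zero : Dec (q x ≡ 0ℚ) → inValue (kind b) + outValue (kind a) ≡ ν x
      by-zero (yes qx≡0) = trans (Rooted.value-outside-K (proj₂ K-nonempty) qx≡0 b∈ b→x a∈ a←x) (sym (ν-zero qx≡0))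
      by-zero (no qx≢0)  = value-in-K qx≢0 b∈ b→x a∈ a←x

  module _ (D : Cycle n) (D⊆C : All (λ a → Σ (Fin t) λ i → a ∈ arcs (C i)) (arcs D)) (D-supp : InSupp g D) where

    private
      D-key : InKeyGraph D
      D-key = supp⇒InKeyGraph {D} D-supp

      D-proper : ∀ {c} → c ∈ arcs D → Proper c
      D-proper = InKeyGraph⇒Proper D D-key

      D-sub : ∀ {c} → c ∈ arcs D → ∃ λ j → c ∈ arcs (C j)
      D-sub = All.lookup D⊆C

    ρ-on-D : ∀ {x} → x ∈ vertices D → ρc (Wcyc D) x ≡ ν x
    ρ-on-D x∈ =
      let (b , b∈ , b→x) = in-arc D x∈
          (a , a∈ , a←x) = out-arc D x∈
      in trans (ρc-cycle D D-proper b∈ b→x a∈ a←x) (mixed-value (proj₂ (D-sub b∈)) b→x (proj₂ (D-sub a∈)) a←x)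

    -- If some z ∈ K were off D, D would meet K nowhere, so its ρ-part would vanish.
    K⊆D : ∀ {z} → q z ≢ 0ℚ → z ∈ vertices D
    K⊆D {z} z∈K = decidable-stable (z ∈? vertices D) (λ z∉D → cycle-ρ-nonzero {D} D-key (ρ-zero z∉D))
      where
        ρ-zero : z ∉ vertices D → ∀ y → ρc (Wcyc D) y ≡ 0ℚ
        ρ-zero z∉D y = by-membership (y ∈? vertices D)
          where
            open Rooted.Avoiding z∈K D D-sub z∉D
            by-membership : Dec (y ∈ vertices D) → ρc (Wcyc D) y ≡ 0ℚ
            by-membership (no y∉)  = ρc-cycle-outside D D-proper y∉
            by-membership (yes y∈) = trans (ρ-on-D y∈)
              (ν-zero (decidable-stable (q y ℚP.≟ 0ℚ) (λ y∈K → K-avoids y∈K y∈)))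

    ρ-D : ∀ x → ρc (Wcyc D) x ≡ ν x
    ρ-D x = by-membership (x ∈? vertices D)
      where
        by-membership : Dec (x ∈ vertices D) → ρc (Wcyc D) x ≡ ν x
        by-membership (yes x∈) = ρ-on-D x∈
        by-membership (no x∉)  = trans (ρc-cycle-outside D D-proper x∉)
          (sym (ν-zero (decidable-stable (q x ℚP.≟ 0ℚ) (x∉ ∘ K⊆D))))

    D-concordant : Wcyc D ≈ᶠ Wcirc g
    D-concordant = ≗ᶠ-≈ᶠ-trans (cycle-form-determined {D} {C i₀} D-key (C-key i₀) ρ-D) (proj₂ (concordant i₀))

proposition5p4 : ∀ {n} (_≺_ : Fin n → Fin n → Set) (ℓ r : Fin n → ℕ)
    → IsCanonical _≺_ ℓ r
    → (g : Arc n → ℚ) → IsCirculation _≺_ ℓ r g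
    → (t : ℕ) → 2 ≤ t → (C : Fin t → Cycle n)
    → (∀ i → Concordant g (C i))
    → (∀ i j → i < j → ¬ (Σ (Cycle n) λ D → All (λ a → a ∈ arcs (C i) ⊎ a ∈ arcs (C j)) (arcs D) × Discordant g D))
    → ¬ (Σ (Cycle n) λ D → All (λ a → Σ (Fin t) λ i → a ∈ arcs (C i)) (arcs D) × Discordant g D)
proposition5p4 _≺_ ℓ r _ g circulation _ t≥2 C concordant pairwise (D , D⊆C , D-supp , ¬D≈g) =
  ¬D≈g (ConcordantFamily.D-concordant _≺_ ℓ r g circulation t≥2 C concordant pairwise D D⊆C D-supp)
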